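{- Let $G=(V,E)$ be a connected graph with $vol(G)\ge11$. If there exists a subset $A\subset V$ with $cut(A,V\setminus A)=2$ and $|vol(A)-vol(G)/2|\le3$, then $Mcut(G)=\min(Mcut_1(G),Mcut_2(G))$.
   Context: For a graph with vertex degrees $d_v$: $vol(S)=\sum_{v\in S}d_v$, $vol(G)=vol(V)$; $cut(S,T)$ is the number of edges between disjoint $S,T$; $Ncut(S,T)=cut(S,T)(1/vol(S)+1/vol(T))$; $Mcut_j(G)=\min\{Ncut(B,V\setminus B):\emptyset\ne B\subsetneq V,\ cut(B,V\setminus B)=j\}$ (convention $\min\emptyset=+\infty$); $Mcut(G)=\min_{j\ge1}Mcut_j(G)$. -}

module Defs where

open import Data.Bool using (Bool; true; false; if_then_else_; not; _∧_)
open import Data.Nat as ℕ using (ℕ; zero; suc; _*_; _≡ᵇ_)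
open import Data.Fin using (Fin; zero; suc)
open import Data.List using (List; []; _∷_; map; foldr; allFin; concatMap; upTo)
open import Data.Nat.ListAction using (sum)
open import Data.Bool.ListAction using (any)
open import Data.Maybe using (Maybe; just; nothing)
open import Data.Integer using (+_)
open import Data.Rational using (ℚ; _/_; _+_; _⊓_)
open import Relation.Binary.PropositionalEquality using (_≡_)
open import Data.Vec.Functional using (Vector)
import Data.Vec.Functional as VF

record Graph : Set where
  field
    n     : ℕ
    adj   : Fin n → Fin n → Bool
    sym   : ∀ u v → adj u v ≡ adj v u
    irref : ∀ v → adj v v ≡ false
open Graph public

VSet : Graph → Set
VSet G = Fin (n G) → Bool

complement : (G : Graph) → VSet G → VSet G
complement G S v = not (S v)

count : Bool → ℕ
count true  = 1
count false = 0

deg : (G : Graph) → Fin (n G) → ℕ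
deg G v = sum (map (λ w → count (adj G v w)) (allFin (n G)))

vol : (G : Graph) → VSet G → ℕ
vol G S = sum (map (λ v → if S v then deg G v else 0) (allFin (n G)))

volG : Graph → ℕ
volG G = vol G (λ _ → true)

cut : (G : Graph) → VSet G → VSet G → ℕ
cut G S T = sum (map (λ u → sum (map (λ w → count (S u ∧ T w ∧ adj G u w))
                                      (allFin (n G))))
                     (allFin (n G)))

data Reach (G : Graph) : Fin (n G) → Fin (n G) → Set where
  here : ∀ {v} → Reach G v v
  step : ∀ {u v w} → adj G u v ≡ true → Reach G v w → Reach G u w

Connected : Graph → Set
Connected G = ∀ u v → Reach G u v

-- extended nonnegative rationals: nothing = +∞
ℚ∞ : Set
ℚ∞ = Maybe ℚ

min∞ : ℚ∞ → ℚ∞ → ℚ∞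
min∞ nothing y = y
min∞ x nothing = x
min∞ (just p) (just q) = just (p ⊓ q)

-- 1/a in ℚ∞ with convention 1/0 = +∞
inv∞ : ℕ → ℚ∞
inv∞ zero    = nothing
inv∞ (suc a) = just ((+ 1) / suc a)

-- Ncut(S,T) = cut(S,T) (1/vol(S) + 1/vol(T)); only used when cut ≥ 1,
-- where both volumes are positive.
Ncut : (G : Graph) → VSet G → VSet G → ℚ∞
Ncut G S T with inv∞ (vol G S) | inv∞ (vol G T)
... | just a | just b = just (((+ cut G S T) / 1) Data.Rational.* (a + b))
... | _      | _      = nothing

allSubsets : (m : ℕ) → List (Vector Bool m)
allSubsets zero    = (λ ()) ∷ []
allSubsets (suc m) = concatMap (λ s → (false VF.∷ s) ∷ (true VF.∷ s) ∷ []) (allSubsets m)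

nonempty : {m : ℕ} → Vector Bool m → Bool
nonempty {m} S = any S (allFin m)

-- Mcut_j(G) = min { Ncut(B, V∖B) : ∅ ≠ B ⊊ V, cut(B, V∖B) = j },  min ∅ = +∞
Mcutⱼ : (G : Graph) → ℕ → ℚ∞
Mcutⱼ G j = foldr (λ B acc →
                     if nonempty B ∧ nonempty (complement G B) ∧ (cut G B (complement G B) ≡ᵇ j)
                     then min∞ (Ncut G B (complement G B)) acc
                     else acc)
                  nothing (allSubsets (n G))

-- Mcut(G) = min_{j ≥ 1} Mcut_j(G).  Since cut(B,V∖B) ≤ |B|·|V∖B| < n·n + 1,
-- Mcut_j(G) = +∞ for j > n·n, so the minimum is over j = 1, …, n·n.
Mcut : Graph → ℚ∞
Mcut G = foldr (λ j acc → min∞ (Mcutⱼ G (suc j)) acc) nothing (upTo (n G * n G))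

module Submission where

-- Let A be the given 2-edge cut, P = vol(A), Q = vol(V∖A), V = P + Q.
-- The hypothesis |P - V/2| ≤ 3 says |P - Q| ≤ 6, and V ≥ 11 then forces
-- P, Q > 0, so Ncut(A) = 2V/(PQ).  For any other bipartition (B, V∖B) with
-- k ≥ 3 crossing edges and volumes R + S = V we have Ncut(B) = kV/(RS), and
--   2RS ≤ V²/2 ≤ 3(V² - 36)/4 ≤ 3PQ          (AM–GM, V² = 4PQ + (P-Q)², V² ≥ 108),
-- hence Ncut(A) ≤ Ncut(B).  So Mcut₂ ≤ Ncut(A) ≤ Mcutₖ for every k ≥ 3, and the
-- minimum over j ≥ 1 collapses to min(Mcut₁, Mcut₂).

module Arithmetic where
  open import Data.Nat
  open import Data.Nat.Properties
  open import Data.Nat.Tactic.RingSolver using (solve-∀)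
  open import Data.Product using (_×_; _,_)
  open import Data.Sum using (inj₁; inj₂)
  open import Data.Empty using (⊥-elim)
  open import Relation.Binary.PropositionalEquality

  square-of-sum-≤ : ∀ {x y} → x ≤ y → (x + y) * (x + y) ≡ 4 * (x * y) + ∣ x - y ∣ * ∣ x - y ∣
  square-of-sum-≤ {x} x≤y with m≤n⇒∃[o]m+o≡n x≤y
  ... | e , refl rewrite ∣m-m+n∣≡n x e = gap x e
    where
    gap : ∀ x e → (x + (x + e)) * (x + (x + e)) ≡ 4 * (x * (x + e)) + e * e
    gap = solve-∀

  square-of-sum : ∀ P Q → (P + Q) * (P + Q) ≡ 4 * (P * Q) + ∣ P - Q ∣ * ∣ P - Q ∣
  square-of-sum P Q with ≤-total P Q
  ... | inj₁ P≤Q = square-of-sum-≤ P≤Q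
  ... | inj₂ Q≤P = begin
    (P + Q) * (P + Q)                    ≡⟨ cong (λ V → V * V) (+-comm P Q) ⟩
    (Q + P) * (Q + P)                    ≡⟨ square-of-sum-≤ Q≤P ⟩
    4 * (Q * P) + ∣ Q - P ∣ * ∣ Q - P ∣  ≡⟨ cong₂ (λ X D → 4 * X + D * D) (*-comm Q P) (∣-∣-comm Q P) ⟩
    4 * (P * Q) + ∣ P - Q ∣ * ∣ P - Q ∣  ∎
    where open ≡-Reasoning

  am-gm : ∀ R S → 4 * (R * S) ≤ (R + S) * (R + S)
  am-gm R S = subst (4 * (R * S) ≤_) (sym (square-of-sum R S)) (m≤m+n _ _)

  -- If P + Q is a split with |P - Q| ≤ d and 3d² ≤ (P + Q)², then 2RS ≤ 3PQ for
  -- every other split R + S of the same sum: 8RS ≤ 2V² ≤ 3V² - 3(P-Q)² = 12PQ.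
  balanced-product : ∀ P Q R S d → R + S ≡ P + Q → ∣ P - Q ∣ ≤ d →
                     3 * (d * d) ≤ (P + Q) * (P + Q) → 2 * (R * S) ≤ 3 * (P * Q)
  balanced-product P Q R S d sums dist bound =
    *-cancelˡ-≤ 4 (+-cancelʳ-≤ (3 * E) (4 * (2 * (R * S))) (4 * (3 * (P * Q))) chain)
    where
    open ≤-Reasoning
    W E : ℕ
    W = (P + Q) * (P + Q)
    E = ∣ P - Q ∣ * ∣ P - Q ∣
    swap : ∀ T → 4 * (2 * T) ≡ 2 * (4 * T)
    swap = solve-∀
    expand : ∀ X D → 3 * (4 * X + D) ≡ 4 * (3 * X) + 3 * D
    expand = solve-∀
    chain : 4 * (2 * (R * S)) + 3 * E ≤ 4 * (3 * (P * Q)) + 3 * E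
    chain = begin
      4 * (2 * (R * S)) + 3 * E  ≡⟨ cong (_+ 3 * E) (swap (R * S)) ⟩
      2 * (4 * (R * S)) + 3 * E  ≤⟨ +-mono-≤ (*-monoʳ-≤ 2 (subst (λ V → 4 * (R * S) ≤ V * V) sums (am-gm R S)))
                                            (*-monoʳ-≤ 3 (*-mono-≤ dist dist)) ⟩
      2 * W + 3 * (d * d)        ≤⟨ +-monoʳ-≤ (2 * W) bound ⟩
      2 * W + W                  ≡⟨ +-comm (2 * W) W ⟩
      3 * W                      ≡⟨ cong (3 *_) (square-of-sum P Q) ⟩
      3 * (4 * (P * Q) + E)      ≡⟨ expand (P * Q) E ⟩
      4 * (3 * (P * Q)) + 3 * E  ∎

  balanced-positive : ∀ P Q d → ∣ P - Q ∣ ≤ d → d < P + Q → 0 < P × 0 < Q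
  balanced-positive zero    Q       d Q≤d d<Q = ⊥-elim (<-irrefl refl (≤-<-trans Q≤d d<Q))
  balanced-positive (suc P) zero    d P≤d d<P =
    ⊥-elim (<-irrefl refl (≤-<-trans P≤d (subst (d <_) (+-identityʳ (suc P)) d<P)))
  balanced-positive (suc P) (suc Q) _ _   _   = z<s , z<s

  -- The comparison 2RS ≤ 3PQ, multiplied out against the common sum V = P + Q = R + S,
  -- in the shape of the cross-multiplied normalised cuts 2V/(PQ) ≤ kV/(RS).
  cross-multiplied : ∀ P Q R S k → R + S ≡ P + Q → 3 ≤ k → 2 * (R * S) ≤ 3 * (P * Q) →
                     2 * (Q + P) * (R * S) ≤ k * (S + R) * (P * Q)
  cross-multiplied P Q R S k sums 3≤k products = begin
    2 * (Q + P) * (R * S)    ≡⟨ regroup 2 (Q + P) (R * S) ⟩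
    (Q + P) * (2 * (R * S))  ≤⟨ *-monoʳ-≤ (Q + P) products ⟩
    (Q + P) * (3 * (P * Q))  ≤⟨ *-monoʳ-≤ (Q + P) (*-monoˡ-≤ (P * Q) 3≤k) ⟩
    (Q + P) * (k * (P * Q))  ≡⟨ regroup k (Q + P) (P * Q) ⟨
    k * (Q + P) * (P * Q)    ≡⟨ cong (λ V → k * V * (P * Q)) same-sum ⟩
    k * (S + R) * (P * Q)    ∎
    where
    open ≤-Reasoning
    regroup : ∀ c V x → c * V * x ≡ V * (c * x)
    regroup = solve-∀
    same-sum : Q + P ≡ S + R
    same-sum = trans (+-comm Q P) (trans (sym sums) (+-comm R S))

module ExtendedRationals where
  open import Defs using (ℚ∞; min∞)
  open import Data.Maybe using (just; nothing)
  open import Data.Rational using (_≤_)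
  import Data.Rational.Properties as QP
  open import Data.Unit using (⊤; tt)
  open import Data.Empty using (⊥)
  open import Relation.Binary.PropositionalEquality using (_≡_; refl; cong)

  _≤∞_ : ℚ∞ → ℚ∞ → Set
  _      ≤∞ nothing = ⊤
  nothing ≤∞ just _ = ⊥
  just p ≤∞ just q  = p ≤ q

  ≤∞-refl : ∀ {x} → x ≤∞ x
  ≤∞-refl {nothing} = tt
  ≤∞-refl {just p}  = QP.≤-refl

  ≤∞-trans : ∀ {x y z} → x ≤∞ y → y ≤∞ z → x ≤∞ z
  ≤∞-trans {z = nothing}                    _   _   = tt
  ≤∞-trans {just _}  {just _}  {just _}     x≤y y≤z = QP.≤-trans x≤y y≤z
  ≤∞-trans {nothing} {just _}  {just _}     ()  _
  ≤∞-trans {_}       {nothing} {just _}     _   ()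

  min∞-≤ˡ : ∀ x y → min∞ x y ≤∞ x
  min∞-≤ˡ nothing  _        = tt
  min∞-≤ˡ (just p) nothing  = QP.≤-refl
  min∞-≤ˡ (just p) (just q) = QP.p⊓q≤p p q

  min∞-≤ʳ : ∀ x y → min∞ x y ≤∞ y
  min∞-≤ʳ nothing  _        = ≤∞-refl
  min∞-≤ʳ (just p) nothing  = tt
  min∞-≤ʳ (just p) (just q) = QP.p⊓q≤q p q

  min∞-glb : ∀ {x y z} → x ≤∞ y → x ≤∞ z → x ≤∞ min∞ y z
  min∞-glb {y = nothing}                _   x≤z = x≤z
  min∞-glb {y = just _} {nothing}       x≤y _   = x≤y
  min∞-glb {just _} {just _} {just _}   x≤y x≤z = QP.⊓-glb x≤y x≤z
  min∞-glb {nothing} {just _} {just _}  ()  _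

  min∞-absorb : ∀ {x y} → x ≤∞ y → min∞ x y ≡ x
  min∞-absorb {nothing} {nothing} _   = refl
  min∞-absorb {just _}  {nothing} _   = refl
  min∞-absorb {just p}  {just q}  p≤q = cong just (QP.p≤q⇒p⊓q≡p p≤q)
  min∞-absorb {nothing} {just _}  ()

module NormalisedCut where
  open import Defs using (ℚ∞)
  open import Data.Maybe using (just; nothing)
  open import Data.Nat as ℕ using (ℕ; zero; suc)
  import Data.Nat.Properties as NP
  open import Data.Integer as ℤ using (+_; _⊖_)
  import Data.Integer.Properties as ℤP
  open import Data.Rational as Q using (ℚ; _/_; toℚᵘ)
  import Data.Rational.Properties as QP
  open import Data.Rational.Unnormalised as U using (ℚᵘ; mkℚᵘ; *≤*)
  import Data.Rational.Unnormalised.Properties as UP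
  open import Data.Product using (proj₁; proj₂)
  open import Data.Sum using (inj₁; inj₂)
  open import Data.Unit using (tt)
  open import Data.Empty using (⊥-elim)
  open import Relation.Binary.PropositionalEquality
  open Arithmetic
  open ExtendedRationals

  -- c·(1/(a+1) + 1/(b+1)): the normalised cut of a bipartition with volumes
  -- a + 1, b + 1 and c crossing edges, as it appears in Defs.Ncut.
  ratio : ℕ → ℕ → ℕ → ℚ
  ratio c a b = ((+ c) / 1) Q.* ((+ 1) / suc a Q.+ (+ 1) / suc b)

  -- The same quantity in unnormalised form, where numerator and denominator are explicit.
  ratioᵘ : ℕ → ℕ → ℕ → ℚᵘ
  ratioᵘ c a b = mkℚᵘ (+ c) 0 U.* (mkℚᵘ (+ 1) a U.+ mkℚᵘ (+ 1) b)

  toℚᵘ-ratio : ∀ c a b → toℚᵘ (ratio c a b) U.≃ ratioᵘ c a b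
  toℚᵘ-ratio c a b = UP.≃-trans (QP.toℚᵘ-homo-* ((+ c) / 1) ((+ 1) / suc a Q.+ (+ 1) / suc b))
    (UP.*-cong (QP.toℚᵘ-fromℚᵘ (mkℚᵘ (+ c) 0))
      (UP.≃-trans (QP.toℚᵘ-homo-+ ((+ 1) / suc a) ((+ 1) / suc b))
        (UP.+-cong (QP.toℚᵘ-fromℚᵘ (mkℚᵘ (+ 1) a)) (QP.toℚᵘ-fromℚᵘ (mkℚᵘ (+ 1) b)))))

  numerator-ratioᵘ : ∀ c a b → U.↥ (ratioᵘ c a b) ≡ + (c ℕ.* (suc b ℕ.+ suc a))
  numerator-ratioᵘ c a b =
    trans (cong (+ c ℤ.*_) (cong₂ ℤ._+_ (ℤP.*-identityˡ (+ suc b)) (ℤP.*-identityˡ (+ suc a))))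
      (trans (cong (+ c ℤ.*_) (sym (ℤP.pos-+ (suc b) (suc a)))) (sym (ℤP.pos-* c _)))

  denominator-ratioᵘ : ∀ c a b → U.↧ (ratioᵘ c a b) ≡ + (suc a ℕ.* suc b)
  denominator-ratioᵘ c a b = cong +_ (NP.*-identityˡ (suc a ℕ.* suc b))

  ratio-≤ : ∀ j a b k c d →
            j ℕ.* (suc b ℕ.+ suc a) ℕ.* (suc c ℕ.* suc d) ℕ.≤ k ℕ.* (suc d ℕ.+ suc c) ℕ.* (suc a ℕ.* suc b) →
            ratio j a b Q.≤ ratio k c d
  ratio-≤ j a b k c d cross = QP.toℚᵘ-cancel-≤
    (UP.≤-respˡ-≃ (UP.≃-sym (toℚᵘ-ratio j a b)) (UP.≤-respʳ-≃ (UP.≃-sym (toℚᵘ-ratio k c d)) (*≤* (subst₂ ℤ._≤_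
      (trans (ℤP.pos-* (j ℕ.* (suc b ℕ.+ suc a)) (suc c ℕ.* suc d))
             (cong₂ ℤ._*_ (sym (numerator-ratioᵘ j a b)) (sym (denominator-ratioᵘ k c d))))
      (trans (ℤP.pos-* (k ℕ.* (suc d ℕ.+ suc c)) (suc a ℕ.* suc b))
             (cong₂ ℤ._*_ (sym (numerator-ratioᵘ k c d)) (sym (denominator-ratioᵘ j a b))))
      (ℤ.+≤+ cross)))))

  ncutValue : ℕ → ℕ → ℕ → ℚ∞
  ncutValue zero    _       _ = nothing
  ncutValue (suc a) zero    _ = nothing
  ncutValue (suc a) (suc b) c = just (ratio c a b)

  ncutValue-balanced-≤ : ∀ P Q R S d k → R ℕ.+ S ≡ P ℕ.+ Q → ℕ.∣ P - Q ∣ ℕ.≤ d → d ℕ.< P ℕ.+ Q →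
                         3 ℕ.* (d ℕ.* d) ℕ.≤ (P ℕ.+ Q) ℕ.* (P ℕ.+ Q) → 3 ℕ.≤ k →
                         ncutValue P Q 2 ≤∞ ncutValue R S k
  ncutValue-balanced-≤ P       Q       zero    S       d k _ _ _ _ _ = tt
  ncutValue-balanced-≤ P       Q       (suc r) zero    d k _ _ _ _ _ = tt
  ncutValue-balanced-≤ zero    Q       (suc r) (suc s) d k _ dist small _ _ =
    ⊥-elim (NP.n≮0 (proj₁ (balanced-positive zero Q d dist small)))
  ncutValue-balanced-≤ (suc p) zero    (suc r) (suc s) d k _ dist small _ _ =
    ⊥-elim (NP.n≮0 (proj₂ (balanced-positive (suc p) zero d dist small)))
  ncutValue-balanced-≤ (suc p) (suc q) (suc r) (suc s) d k sums dist _ bound 3≤k =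
    ratio-≤ 2 p q k r s (cross-multiplied (suc p) (suc q) (suc r) (suc s) k sums 3≤k
      (balanced-product (suc p) (suc q) (suc r) (suc s) d sums dist bound))

  ∣⊖∣≡∣-∣ : ∀ m n → ℤ.∣ m ⊖ n ∣ ≡ ℕ.∣ m - n ∣
  ∣⊖∣≡∣-∣ m n with NP.≤-total m n
  ... | inj₁ m≤n = trans (ℤP.∣⊖∣-≤ m≤n) (sym (NP.m≤n⇒∣m-n∣≡n∸m m≤n))
  ... | inj₂ n≤m = trans (ℤP.∣m⊖n∣≡∣n⊖m∣ m n) (trans (ℤP.∣⊖∣-≤ n≤m) (sym (NP.m≤n⇒∣n-m∣≡n∸m n≤m)))

  -- P - (P + Q)/2 in unnormalised form.
  offsetᵘ : ℕ → ℕ → ℚᵘ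
  offsetᵘ P V = mkℚᵘ (+ P) 0 U.- mkℚᵘ (+ V) 1

  toℚᵘ-offset : ∀ P V → toℚᵘ ((+ P) / 1 Q.- (+ V) / 2) U.≃ offsetᵘ P V
  toℚᵘ-offset P V = UP.≃-trans (QP.toℚᵘ-homo-+ ((+ P) / 1) (Q.- ((+ V) / 2)))
    (UP.+-cong (QP.toℚᵘ-fromℚᵘ (mkℚᵘ (+ P) 0))
       (UP.≃-trans (QP.toℚᵘ-homo‿- ((+ V) / 2)) (UP.-‿cong (QP.toℚᵘ-fromℚᵘ (mkℚᵘ (+ V) 1)))))

  numerator-offsetᵘ : ∀ P V → U.↥ (offsetᵘ P V) ≡ (P ℕ.* 2) ⊖ V
  numerator-offsetᵘ P V = trans (cong₂ ℤ._+_ (sym (ℤP.pos-* P 2)) (ℤP.*-identityʳ (ℤ.- (+ V))))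
                                (ℤP.m-n≡m⊖n (P ℕ.* 2) V)

  doubled-offset : ∀ P Q → ℤ.∣ (P ℕ.* 2) ⊖ (P ℕ.+ Q) ∣ ≡ ℕ.∣ P - Q ∣
  doubled-offset P Q = begin
    ℤ.∣ (P ℕ.* 2) ⊖ (P ℕ.+ Q) ∣   ≡⟨ cong (λ x → ℤ.∣ x ⊖ (P ℕ.+ Q) ∣) double ⟩
    ℤ.∣ (P ℕ.+ P) ⊖ (P ℕ.+ Q) ∣   ≡⟨ cong ℤ.∣_∣ (ℤP.+-cancelˡ-⊖ P P Q) ⟩
    ℤ.∣ P ⊖ Q ∣                   ≡⟨ ∣⊖∣≡∣-∣ P Q ⟩
    ℕ.∣ P - Q ∣                   ∎
    where
    open ≡-Reasoning
    double : P ℕ.* 2 ≡ P ℕ.+ P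
    double = trans (NP.*-comm P 2) (cong (P ℕ.+_) (NP.+-identityʳ P))

  half-distance : ∀ P Q d → Q.∣ (+ P) / 1 Q.- (+ (P ℕ.+ Q)) / 2 ∣ Q.≤ (+ d) / 1 → ℕ.∣ P - Q ∣ ℕ.≤ d ℕ.* 2
  half-distance P Q d offset≤d with boundᵘ
    where
    boundᵘ : U.∣ offsetᵘ P (P ℕ.+ Q) ∣ U.≤ mkℚᵘ (+ d) 0
    boundᵘ = UP.≤-respˡ-≃ (UP.≃-trans (QP.toℚᵘ-homo-∣-∣ _) (UP.∣-∣-cong (toℚᵘ-offset P (P ℕ.+ Q))))
               (UP.≤-respʳ-≃ (QP.toℚᵘ-fromℚᵘ (mkℚᵘ (+ d) 0)) (QP.toℚᵘ-mono-≤ offset≤d))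
  ... | *≤* cross = subst (ℕ._≤ d ℕ.* 2)
      (trans (cong ℤ.∣_∣ (numerator-offsetᵘ P (P ℕ.+ Q))) (doubled-offset P Q))
      (ℤP.drop‿+≤+ (subst₂ ℤ._≤_ (ℤP.*-identityʳ _) (sym (ℤP.pos-* d 2)) cross))

module GraphFacts where
  open import Defs hiding (sym)
  open import Data.Bool using (Bool; true; false; if_then_else_; not; _∧_)
  open import Data.Bool.ListAction using (or)
  open import Data.Nat using (ℕ; zero; suc; _+_; _≤_; _<_; s≤s; z≤n)
  import Data.Nat.Properties as NP
  open import Data.Fin using (zero; suc)
  open import Data.List using ([]; _∷_; map; allFin)
  open import Data.List.Properties using (map-cong)
  open import Data.Nat.ListAction using (sum)
  open import Data.List.Relation.Unary.Any using (Any; here; there)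
  import Data.List.Relation.Unary.Any as Any
  open import Data.List.Relation.Unary.Any.Properties using (concatMap⁺)
  open import Data.Vec.Functional using (Vector; tail)
  import Data.Vec.Functional as Vec
  open import Data.Empty using (⊥-elim)
  open import Relation.Binary.PropositionalEquality
  open NormalisedCut using (ncutValue)

  sum-map-+ : ∀ {A : Set} (f g : A → ℕ) xs → sum (map f xs) + sum (map g xs) ≡ sum (map (λ x → f x + g x) xs)
  sum-map-+ f g []       = refl
  sum-map-+ f g (x ∷ xs) = trans (regroup (f x) _ (g x) _) (cong ((f x + g x) +_) (sum-map-+ f g xs))
    where
    regroup : ∀ a b c d → (a + b) + (c + d) ≡ (a + c) + (b + d)
    regroup a b c d = trans (NP.+-assoc a b (c + d))
      (trans (cong (a +_) (trans (sym (NP.+-assoc b c d)) (trans (cong (_+ d) (NP.+-comm b c)) (NP.+-assoc c b d))))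
        (sym (NP.+-assoc a c (b + d))))

  vol-complement : ∀ G S → vol G S + vol G (complement G S) ≡ volG G
  vol-complement G S = trans (sum-map-+ _ _ (allFin (n G)))
      (cong sum (map-cong (λ v → split (S v) (deg G v)) (allFin (n G))))
    where
    split : ∀ b d → (if b then d else 0) + (if not b then d else 0) ≡ d
    split true  d = NP.+-identityʳ d
    split false d = refl

  vol-cong : ∀ G {S S'} → S ≗ S' → vol G S ≡ vol G S'
  vol-cong G e = cong sum (map-cong (λ v → cong (λ b → if b then deg G v else 0) (e v)) (allFin (n G)))

  cut-cong : ∀ G {S S' T T'} → S ≗ S' → T ≗ T' → cut G S T ≡ cut G S' T'
  cut-cong G e f = cong sum (map-cong (λ u → cong sum (map-cong (λ w →
    cong₂ (λ x y → count (x ∧ y ∧ adj G u w)) (e u) (f w)) (allFin (n G)))) (allFin (n G)))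

  nonempty-cong : ∀ {m} {S S' : Vector Bool m} → S ≗ S' → nonempty S ≡ nonempty S'
  nonempty-cong {m} e = cong or (map-cong e (allFin m))

  vol-positive⇒nonempty : ∀ G S → 0 < vol G S → nonempty S ≡ true
  vol-positive⇒nonempty G S positive with nonempty S in empty?
  ... | true  = refl
  ... | false = ⊥-elim (NP.<-irrefl (sym (vol-over-empty (allFin (n G)) empty?)) positive)
    where
    vol-over-empty : ∀ xs → or (map S xs) ≡ false → sum (map (λ v → if S v then deg G v else 0) xs) ≡ 0
    vol-over-empty []       _ = refl
    vol-over-empty (x ∷ xs) e with S x
    vol-over-empty (x ∷ xs) () | true
    vol-over-empty (x ∷ xs) e  | false = vol-over-empty xs e

  allSubsets-complete : ∀ m (A : Vector Bool m) → Any (_≗ A) (allSubsets m)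
  allSubsets-complete zero    A = here (λ ())
  allSubsets-complete (suc m) A = concatMap⁺ _ (Any.map extend (allSubsets-complete m (tail A)))
    where
    extend : ∀ {B} → B ≗ tail A → Any (_≗ A) ((false Vec.∷ B) ∷ (true Vec.∷ B) ∷ [])
    extend B≗ with A zero in head
    ... | false = here λ { zero → sym head ; (suc i) → B≗ i }
    ... | true  = there (here λ { zero → sym head ; (suc i) → B≗ i })

  two-vertices : ∀ G (A : VSet G) {c} → cut G A (complement G A) ≡ suc c → 2 ≤ n G
  two-vertices record { n = zero }          A ()
  two-vertices record { n = suc zero }      A cut≡ with A zero
  two-vertices record { n = suc zero }      A () | true
  two-vertices record { n = suc zero }      A () | false
  two-vertices record { n = suc (suc m) }   A _  = s≤s (s≤s z≤n)

  Ncut≡ncutValue : ∀ G S T → Ncut G S T ≡ ncutValue (vol G S) (vol G T) (cut G S T)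
  Ncut≡ncutValue G S T with vol G S | vol G T
  ... | zero  | _     = refl
  ... | suc a | zero  = refl
  ... | suc a | suc b = refl

  Ncut-at : ∀ G S {c} → cut G S (complement G S) ≡ c →
            Ncut G S (complement G S) ≡ ncutValue (vol G S) (vol G (complement G S)) c
  Ncut-at G S cut≡ = trans (Ncut≡ncutValue G S (complement G S)) (cong (ncutValue _ _) cut≡)

  Ncut-cong : ∀ G {S S' T T'} → S ≗ S' → T ≗ T' → Ncut G S T ≡ Ncut G S' T'
  Ncut-cong G {S} {S'} {T} {T'} e f = begin
    Ncut G S T                                       ≡⟨ Ncut≡ncutValue G S T ⟩
    ncutValue (vol G S) (vol G T) (cut G S T)        ≡⟨ cong₂ (λ a b → ncutValue a b (cut G S T)) (vol-cong G e) (vol-cong G f) ⟩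
    ncutValue (vol G S') (vol G T') (cut G S T)      ≡⟨ cong (ncutValue _ _) (cut-cong G e f) ⟩
    ncutValue (vol G S') (vol G T') (cut G S' T')    ≡⟨ Ncut≡ncutValue G S' T' ⟨
    Ncut G S' T'                                     ∎
    where open ≡-Reasoning

module Minimisation where
  open import Defs hiding (sym)
  open import Data.Bool using (Bool; true; false; if_then_else_; not; _∧_)
  open import Data.Bool.Properties using (∧-conicalʳ; T-≡)
  open import Data.Nat using (ℕ; zero; suc; _+_; _*_; _≡ᵇ_; _≤_; s≤s)
  import Data.Nat.Properties as NP
  open import Data.List using (List; []; _∷_; foldr; applyUpTo; upTo)
  open import Data.List.Relation.Unary.Any using (Any; here; there)
  import Data.List.Relation.Unary.Any as Any
  open import Data.Maybe using (nothing)
  open import Data.Product using (_×_; _,_)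
  open import Data.Unit using (tt)
  open import Function.Bundles using (Equivalence)
  open import Relation.Binary.PropositionalEquality
  open ExtendedRationals
  open GraphFacts

  minWhere : {A : Set} → (A → Bool) → (A → ℚ∞) → List A → ℚ∞
  minWhere c v = foldr (λ x acc → if c x then min∞ (v x) acc else acc) nothing

  minWhere-lower : ∀ {A : Set} (c : A → Bool) v xs {q} → (∀ x → c x ≡ true → q ≤∞ v x) → q ≤∞ minWhere c v xs
  minWhere-lower c v []       bound = tt
  minWhere-lower c v (x ∷ xs) bound with c x in chosen
  ... | true  = min∞-glb (bound x chosen) (minWhere-lower c v xs bound)
  ... | false = minWhere-lower c v xs bound

  minWhere-upper : ∀ {A : Set} (c : A → Bool) v xs {r} → Any (λ x → c x ≡ true × v x ≡ r) xs → minWhere c v xs ≤∞ r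
  minWhere-upper c v (x ∷ xs) (here (chosen , refl)) rewrite chosen = min∞-≤ˡ (v x) (minWhere c v xs)
  minWhere-upper c v (x ∷ xs) (there found) with c x
  ... | true  = ≤∞-trans (min∞-≤ʳ (v x) (minWhere c v xs)) (minWhere-upper c v xs found)
  ... | false = minWhere-upper c v xs found

  minApplyUpTo-lower : ∀ (F : ℕ → ℚ∞) g k {q} → (∀ i → q ≤∞ F (g i)) →
                       q ≤∞ foldr (λ j acc → min∞ (F j) acc) nothing (applyUpTo g k)
  minApplyUpTo-lower F g zero    below = tt
  minApplyUpTo-lower F g (suc k) below = min∞-glb (below 0) (minApplyUpTo-lower F (λ i → g (suc i)) k (λ i → below (suc i)))

  minUpTo-collapse : ∀ (F : ℕ → ℚ∞) N → 2 ≤ N → (∀ i → F 1 ≤∞ F (2 + i)) →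
                     foldr (λ j acc → min∞ (F j) acc) nothing (upTo N) ≡ min∞ (F 0) (F 1)
  minUpTo-collapse F (suc (suc k)) (s≤s (s≤s _)) below =
    cong (min∞ (F 0)) (min∞-absorb (minApplyUpTo-lower F (λ i → suc (suc i)) k below))

  Mcutⱼ-upper : ∀ G A → nonempty A ≡ true → nonempty (complement G A) ≡ true →
                Mcutⱼ G (cut G A (complement G A)) ≤∞ Ncut G A (complement G A)
  Mcutⱼ-upper G A nonemptyA nonemptyAᶜ =
    minWhere-upper _ _ (allSubsets (n G)) (Any.map selected (allSubsets-complete (n G) A))
    where
    Aᶜ = complement G A
    selected : ∀ {B} → B ≗ A →
      (nonempty B ∧ nonempty (complement G B) ∧ (cut G B (complement G B) ≡ᵇ cut G A Aᶜ)) ≡ true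
      × Ncut G B (complement G B) ≡ Ncut G A Aᶜ
    selected B≗A = cong₂ _∧_ (trans (nonempty-cong B≗A) nonemptyA)
                     (cong₂ _∧_ (trans (nonempty-cong Bᶜ≗Aᶜ) nonemptyAᶜ)
                       (trans (cong (_≡ᵇ cut G A Aᶜ) (cut-cong G B≗A Bᶜ≗Aᶜ))
                              (Equivalence.to T-≡ (NP.≡⇒≡ᵇ (cut G A Aᶜ) _ refl))))
                 , Ncut-cong G B≗A Bᶜ≗Aᶜ
      where
      Bᶜ≗Aᶜ : complement G _ ≗ Aᶜ
      Bᶜ≗Aᶜ i = cong not (B≗A i)

  Mcutⱼ-lower : ∀ G j {q} → (∀ B → cut G B (complement G B) ≡ j → q ≤∞ Ncut G B (complement G B)) →
                q ≤∞ Mcutⱼ G j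
  Mcutⱼ-lower G j bound = minWhere-lower _ _ (allSubsets (n G)) λ B chosen →
    bound B (NP.≡ᵇ⇒≡ _ j (Equivalence.from T-≡
      (∧-conicalʳ (nonempty (complement G B)) _ (∧-conicalʳ (nonempty B) _ chosen))))

  Mcut-collapse : ∀ G → 2 ≤ n G → (∀ i → Mcutⱼ G 2 ≤∞ Mcutⱼ G (3 + i)) → Mcut G ≡ min∞ (Mcutⱼ G 1) (Mcutⱼ G 2)
  Mcut-collapse G 2≤n = minUpTo-collapse (λ j → Mcutⱼ G (suc j)) (n G * n G) (NP.≤-trans (NP.m≤m+n 2 2) (NP.*-mono-≤ 2≤n 2≤n))

open import Defs hiding (sym)
open import Data.Nat using (_≥_)
open import Data.Product using (Σ; _×_)
open import Data.Integer using (+_)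
open import Data.Rational using (_/_; _-_; ∣_∣; _≤_)
open import Relation.Binary.PropositionalEquality using (_≡_)

import Data.Nat as ℕ
import Data.Nat.Properties as NP
open import Data.Product using (_,_; proj₁; proj₂)
open import Relation.Binary.PropositionalEquality using (sym; trans; subst; subst₂)
open Arithmetic using (balanced-positive)
open ExtendedRationals
open NormalisedCut
open GraphFacts
open Minimisation

lemma11 : (G : Graph) → Connected G → volG G ≥ 11 →
    Σ (VSet G) (λ A → (cut G A (complement G A) ≡ 2) ×
    (∣ (+ vol G A) / 1 - (+ volG G) / 2 ∣ ≤ (+ 3) / 1)) →
    Mcut G ≡ min∞ (Mcutⱼ G 1) (Mcutⱼ G 2)
lemma11 G _ volG≥11 (A , cutA≡2 , near-half) =
  Mcut-collapse G (two-vertices G A cutA≡2) λ i →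
    ≤∞-trans Mcut₂≤NcutA (Mcutⱼ-lower G (3 ℕ.+ i) λ B cutB≡ →
      subst₂ _≤∞_ (sym (Ncut-at G A cutA≡2)) (sym (Ncut-at G B cutB≡))
        (ncutValue-balanced-≤ P Q (vol G B) (vol G (complement G B)) 6 (3 ℕ.+ i)
          (trans (vol-complement G B) (sym P+Q≡V)) distance 6<P+Q 108≤V² (NP.m≤m+n 3 i)))
  where
  P Q : ℕ.ℕ
  P = vol G A
  Q = vol G (complement G A)
  P+Q≡V : P ℕ.+ Q ≡ volG G
  P+Q≡V = vol-complement G A
  11≤P+Q : 11 ℕ.≤ P ℕ.+ Q
  11≤P+Q = subst (11 ℕ.≤_) (sym P+Q≡V) volG≥11
  6<P+Q : 6 ℕ.< P ℕ.+ Q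
  6<P+Q = NP.≤-trans (NP.m≤m+n 7 4) 11≤P+Q
  108≤V² : 3 ℕ.* (6 ℕ.* 6) ℕ.≤ (P ℕ.+ Q) ℕ.* (P ℕ.+ Q)
  108≤V² = NP.≤-trans (NP.m≤m+n 108 13) (NP.*-mono-≤ 11≤P+Q 11≤P+Q)
  distance : ℕ.∣ P - Q ∣ ℕ.≤ 6
  distance = half-distance P Q 3 (subst (λ V → ∣ (+ P) / 1 - (+ V) / 2 ∣ ≤ (+ 3) / 1) (sym P+Q≡V) near-half)
  positive : 0 ℕ.< P × 0 ℕ.< Q
  positive = balanced-positive P Q 6 distance 6<P+Q
  Mcut₂≤NcutA : Mcutⱼ G 2 ≤∞ Ncut G A (complement G A)
  Mcut₂≤NcutA = subst (λ j → Mcutⱼ G j ≤∞ Ncut G A (complement G A)) cutA≡2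
    (Mcutⱼ-upper G A (vol-positive⇒nonempty G A (proj₁ positive)) (vol-positive⇒nonempty G _ (proj₂ positive)))
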